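{- For every integer $k\geq 1$, $\mathsf{APS}^B_{2k} = \mathsf{APS}^D_{2k}$.
   Context: For $n\in\mathbb{N}$, $[n]=\{1,\dots,n\}$ and $\pm[n]=[n]\cup -[n]$. The group $\mathfrak{S}_n^B$ of signed permutations consists of the bijections $w:\pm[n]\to\pm[n]$ with $w(-i)=-w(i)$ for all $i$, written in one-line notation $w(1)\cdots w(n)$. $\mathfrak{S}_n^D\subseteq\mathfrak{S}_n^B$ is the subgroup of those $w$ for which $|\{i\in[n]: w(i)<0\}|$ is even. A pinnacle of $w$ is a value $w(i)$ with $2\le i\le n-1$ and $w(i-1)<w(i)>w(i+1)$; the pinnacle set of $w$ is the set of its pinnacles. $\mathsf{APS}^B_n$ (resp. $\mathsf{APS}^D_n$) is the set of subsets of $\pm[n]$ that are the pinnacle set of some $w\in\mathfrak{S}_n^B$ (resp. $w\in\mathfrak{S}_n^D$). -}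

module Defs where

open import Data.Nat as ℕ using (ℕ; zero; suc; _+_; _*_; _≤_; s≤s)
open import Data.Nat.Properties using (<-trans; n<1+n)
open import Data.Nat.Divisibility using (_∣_)
open import Data.Integer as ℤ using (ℤ; +_; -_; 0ℤ)
open import Data.Integer.Properties using () renaming (_<?_ to _<ℤ?_)
open import Data.Bool using (Bool; true; false; if_then_else_)
open import Data.Fin using (Fin; toℕ; fromℕ<)
open import Data.Fin.Permutation using (Permutation′; _⟨$⟩ʳ_)
open import Data.List using (List; length; filter; allFin)
open import Data.Product using (Σ; ∃; _×_)
open import Relation.Binary.PropositionalEquality using (_≡_)
open import Function.Bundles using (_⇔_)

-- Its one-line notation is w(i) = ±(π(i)), the sign being
-- negative exactly when neg i = true.  (Positions and values are 1-based in
-- the paper; here Fin n is 0-based, so value = 1 + toℕ (π i).)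
record SignedPerm (n : ℕ) : Set where
  field
    perm : Permutation′ n
    neg  : Fin n → Bool

oneLine : ∀ {n} → SignedPerm n → Fin n → ℤ
oneLine w i =
  let v = + suc (toℕ (SignedPerm.perm w ⟨$⟩ʳ i))
  in if SignedPerm.neg w i then - v else v

negCount : ∀ {n} → SignedPerm n → ℕ
negCount {n} w = length (filter (λ i → oneLine w i <ℤ? 0ℤ) (allFin n))

IsTypeD : ∀ {n} → SignedPerm n → Set
IsTypeD w = 2 ∣ negCount w

-- value at 0-based position j (i.e. w(j+1))
at : ∀ {n} → SignedPerm n → (j : ℕ) → j ℕ.< n → ℤ
at w j p = oneLine w (fromℕ< p)

-- x is a pinnacle of w: x = w(i) for some 2 ≤ i ≤ n-1 (1-based) with
-- w(i-1) < w(i) > w(i+1).  Here, 0-based, the middle position is j+1 with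
-- j + 2 < n.
IsPinnacle : ∀ {n} → SignedPerm n → ℤ → Set
IsPinnacle {n} w x =
  Σ ℕ λ j → Σ (suc (suc j) ℕ.< n) λ p →
    let p1 = <-trans (n<1+n (suc j)) p
        p0 = <-trans (n<1+n j) p1
    in (at w j p0 ℤ.< at w (suc j) p1)
       × (at w (suc (suc j)) p ℤ.< at w (suc j) p1)
       × (at w (suc j) p1 ≡ x)

Subsetℤ : Set₁
Subsetℤ = ℤ → Set

InAPSB : ℕ → Subsetℤ → Set
InAPSB n S = Σ (SignedPerm n) λ w → ∀ x → (S x ⇔ IsPinnacle w x)

InAPSD : ℕ → Subsetℤ → Set
InAPSD n S = Σ (SignedPerm n) λ w → IsTypeD w × (∀ x → (S x ⇔ IsPinnacle w x))

-- When n is even, a signed permutation w with an odd number of negative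
-- entries can be repaired without changing its pinnacle set.  Peaks are never
-- adjacent and the two ends are never peaks, so an even length forces two
-- adjacent non-peaks; one of them can be deleted without changing the
-- pinnacles.  Its negation can then be reinserted without creating or
-- destroying a pinnacle: into a descent that straddles it, or, if it lies below
-- every entry, at the front, into a valley, or at the end.  Exactly one sign
-- has changed, so the number of negative entries becomes even.
{-# OPTIONS --safe #-}
module Submission where

open import Defs
open import Data.Nat as ℕ using (ℕ; zero; suc; _≤_; _<_; z≤n; s≤s; _+_; _*_)
import Data.Nat.Properties as ℕ
open import Data.Nat.Divisibility using (_∣_; divides; _∣?_; m∣m*n)
open import Data.Integer as ℤ using (ℤ; +_; -_; -[1+_]; 0ℤ) renaming (_<_ to _<ᶻ_)
import Data.Integer.Properties as ℤ
open import Data.Bool using (true; false; if_then_else_; _xor_)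
open import Data.Fin as Fin using (Fin; toℕ; fromℕ<; punchIn)
import Data.Fin.Properties as Fin
open import Data.Fin.Permutation using (_⟨$⟩ʳ_; insert; id; _∘ₚ_; insert-punchIn)
open import Data.List using (length; filter; tabulate)
open import Data.Product using (Σ; _×_; _,_; proj₂)
open import Data.Sum using (_⊎_; inj₁; inj₂)
open import Data.Empty using (⊥; ⊥-elim)
open import Relation.Nullary using (¬_; Dec; yes; no; does)
open import Relation.Nullary.Decidable using (_×-dec_; dec-yes; dec-no)
import Relation.Unary as U
open import Relation.Binary.PropositionalEquality
open import Relation.Binary.Definitions using (tri<; tri≈; tri>)
open import Function using (_∘_)
open import Function.Bundles using (_⇔_; mk⇔; Equivalence; Injection)
import Function.Properties.Equivalence as ⇔
open import Function.Properties.Inverse using (↔⇒↣)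
open import Algebra.Properties.CommutativeMonoid.Sum ℕ.+-0-commutativeMonoid
  using (sum; sum-remove; sum-cong-≗)

open Equivalence using (to; from)

-- Sequences of length N are functions ℕ → ℤ whose values from position N on
-- are ignored; positions are 0-based, so Peak N F c needs 1 ≤ c ≤ N - 2.
Peak : ℕ → (ℕ → ℤ) → ℕ → Set
Peak N F zero    = ⊥
Peak N F (suc j) = suc (suc j) < N × F j <ᶻ F (suc j) × F (suc (suc j)) <ᶻ F (suc j)

peak? : ∀ N F c → Dec (Peak N F c)
peak? N F zero    = no λ ()
peak? N F (suc j) =
  (suc (suc j) ℕ.<? N) ×-dec (F j ℤ.<? F (suc j)) ×-dec (F (suc (suc j)) ℤ.<? F (suc j))

Pinnacle : ℕ → (ℕ → ℤ) → ℤ → Set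
Pinnacle N F x = Σ ℕ λ c → Peak N F c × F c ≡ x

Distinct : ℕ → (ℕ → ℤ) → Set
Distinct N F = ∀ a b → a < N → b < N → a ≢ b → F a ≢ F b

peak-via : ∀ {L j} G {x y z : ℤ} → suc (suc j) < L →
           G j ≡ x → G (suc j) ≡ y → G (suc (suc j)) ≡ z → x <ᶻ y → z <ᶻ y → Peak L G (suc j)
peak-via G bound refl refl refl x<y z<y = bound , x<y , z<y

peak-cong : ∀ {N F} G c → (∀ {j} → j < N → F j ≡ G j) → Peak N F c → Peak N G c
peak-cong G (suc j) F≗G (bound , l , r) =
  peak-via G bound (sym (F≗G j<N)) (sym (F≗G j+1<N)) (sym (F≗G bound)) l r
  where
  j+1<N = ℕ.<-trans (ℕ.n<1+n _) bound
  j<N   = ℕ.<-trans (ℕ.n<1+n _) j+1<N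

pinnacle-cong : ∀ {N F x} G → (∀ {j} → j < N → F j ≡ G j) → Pinnacle N F x → Pinnacle N G x
pinnacle-cong G F≗G (suc j , peak@(bound , _) , e) =
  suc j , peak-cong G (suc j) F≗G peak , trans (sym (F≗G (ℕ.<-trans (ℕ.n<1+n _) bound))) e

punchInℕ : ℕ → ℕ → ℕ
punchInℕ zero    j       = suc j
punchInℕ (suc r) zero    = zero
punchInℕ (suc r) (suc j) = suc (punchInℕ r j)

punchInℕ-< : ∀ {r j} → j < r → punchInℕ r j ≡ j
punchInℕ-< {suc r} {zero}  _         = refl
punchInℕ-< {suc r} {suc j} (s≤s j<r) = cong suc (punchInℕ-< j<r)

punchInℕ-≥ : ∀ {r j} → r ≤ j → punchInℕ r j ≡ suc j
punchInℕ-≥ {zero}  _         = refl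
punchInℕ-≥ {suc r} (s≤s r≤j) = cong suc (punchInℕ-≥ r≤j)

punchInℕ-bounded : ∀ {r j M} → r ≤ M → j < M → punchInℕ r j < suc M
punchInℕ-bounded {zero}  _         j<M       = s≤s j<M
punchInℕ-bounded {suc r} {zero}  _ (s≤s _)   = s≤s z≤n
punchInℕ-bounded {suc r} {suc j} (s≤s r≤M) (s≤s j<M) = s≤s (punchInℕ-bounded r≤M j<M)

punchInℕᵣ≢r : ∀ r j → punchInℕ r j ≢ r
punchInℕᵣ≢r (suc r) (suc j) e = punchInℕᵣ≢r r j (ℕ.suc-injective e)

punchInℕ-injective : ∀ r {a b} → punchInℕ r a ≡ punchInℕ r b → a ≡ b
punchInℕ-injective zero    e = ℕ.suc-injective e
punchInℕ-injective (suc r) {zero}  {zero}  e = refl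
punchInℕ-injective (suc r) {suc a} {suc b} e = cong suc (punchInℕ-injective r (ℕ.suc-injective e))

-- Deleting F r only shifts the entries after r, so the peak status can change
-- only at r and at its two neighbours.
record Removable (M : ℕ) (F : ℕ → ℤ) (r : ℕ) : Set where
  field
    not-peak  : ¬ Peak (suc M) F r
    peak-pred : ∀ {c} → suc c ≡ r → Peak (suc M) F c ⇔ Peak M (F ∘ punchInℕ r) c
    peak-succ : Peak (suc M) F (suc r) ⇔ Peak M (F ∘ punchInℕ r) r

peak-left : ∀ {M r j} F → r ≤ M → suc (suc j) < r →
            Peak (suc M) F (suc j) ⇔ Peak M (F ∘ punchInℕ r) (suc j)
peak-left {M} {r} {j} F r≤M j+2<r = mk⇔
  (λ (_ , l , u) → peak-via (F ∘ punchInℕ r) (ℕ.<-≤-trans j+2<r r≤M)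
                     (cong F fix₀) (cong F fix₁) (cong F fix₂) l u)
  (λ (bound , l , u) → peak-via F (ℕ.m<n⇒m<1+n bound)
                         (cong F (sym fix₀)) (cong F (sym fix₁)) (cong F (sym fix₂)) l u)
  where
  j+1<r = ℕ.<-trans (ℕ.n<1+n _) j+2<r
  fix₀ = punchInℕ-< (ℕ.<-trans (ℕ.n<1+n _) j+1<r)
  fix₁ = punchInℕ-< j+1<r
  fix₂ = punchInℕ-< j+2<r

peak-right : ∀ {M r j} F → r ≤ j →
             Peak (suc M) F (suc (suc j)) ⇔ Peak M (F ∘ punchInℕ r) (suc j)
peak-right {M} {r} {j} F r≤j = mk⇔
  (λ (bound , l , u) → peak-via (F ∘ punchInℕ r) (ℕ.≤-pred bound)
                         (cong F shift₀) (cong F shift₁) (cong F shift₂) l u)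
  (λ (bound , l , u) → peak-via F (s≤s bound)
                         (cong F (sym shift₀)) (cong F (sym shift₁)) (cong F (sym shift₂)) l u)
  where
  shift₀ = punchInℕ-≥ r≤j
  shift₁ = punchInℕ-≥ (ℕ.m≤n⇒m≤1+n r≤j)
  shift₂ = punchInℕ-≥ (ℕ.m≤n⇒m≤1+n (ℕ.m≤n⇒m≤1+n r≤j))

module _ {M F r} (r≤M : r ≤ M) (R : Removable M F r) where
  open Removable R

  pinnacle-remove⁺ : ∀ {x} → Pinnacle (suc M) F x → Pinnacle M (F ∘ punchInℕ r) x
  pinnacle-remove⁺ (suc j , peak , e) with ℕ.<-cmp j r
  ... | tri≈ _ refl _ = r , to peak-succ peak , trans (cong F (punchInℕ-≥ ℕ.≤-refl)) e
  ... | tri> _ _ (s≤s r≤j) =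
    suc _ , to (peak-right F r≤j) peak , trans (cong F (punchInℕ-≥ (ℕ.m≤n⇒m≤1+n r≤j))) e
  ... | tri< j<r _ _ with ℕ.m≤n⇒m<n∨m≡n j<r
  ...   | inj₂ refl = ⊥-elim (not-peak peak)
  ...   | inj₁ j+1<r with ℕ.m≤n⇒m<n∨m≡n j+1<r
  ...     | inj₁ j+2<r = suc j , to (peak-left F r≤M j+2<r) peak , trans (cong F (punchInℕ-< j+1<r)) e
  ...     | inj₂ j+2≡r = suc j , to (peak-pred j+2≡r) peak , trans (cong F (punchInℕ-< j+1<r)) e

  pinnacle-remove⁻ : ∀ {x} → Pinnacle M (F ∘ punchInℕ r) x → Pinnacle (suc M) F x
  pinnacle-remove⁻ (suc j , peak , e) with ℕ.<-cmp (suc j) r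
  ... | tri≈ _ refl _ = suc (suc j) , from peak-succ peak , trans (cong F (sym (punchInℕ-≥ ℕ.≤-refl))) e
  ... | tri> _ _ (s≤s r≤j) =
    suc (suc j) , from (peak-right F r≤j) peak , trans (cong F (sym (punchInℕ-≥ (ℕ.m≤n⇒m≤1+n r≤j)))) e
  ... | tri< j+1<r _ _ with ℕ.m≤n⇒m<n∨m≡n j+1<r
  ...   | inj₁ j+2<r = suc j , from (peak-left F r≤M j+2<r) peak , trans (cong F (sym (punchInℕ-< j+1<r))) e
  ...   | inj₂ j+2≡r = suc j , from (peak-pred j+2≡r) peak , trans (cong F (sym (punchInℕ-< j+1<r))) e

pinnacles-remove : ∀ {M F r} → r ≤ M → Removable M F r →
                   ∀ x → Pinnacle (suc M) F x ⇔ Pinnacle M (F ∘ punchInℕ r) x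
pinnacles-remove r≤M R x = mk⇔ (pinnacle-remove⁺ r≤M R) (pinnacle-remove⁻ r≤M R)

≢∧≮⇒> : ∀ {a b : ℤ} → a ≢ b → ¬ (a <ᶻ b) → b <ᶻ a
≢∧≮⇒> a≢b a≮b = ℤ.≤∧≢⇒< (ℤ.≮⇒≥ a≮b) (a≢b ∘ sym)

distinct-adjacent : ∀ {N F j} → Distinct N F → suc j < N → F j ≢ F (suc j)
distinct-adjacent distinct j+1<N = distinct _ _ (ℕ.<-trans (ℕ.n<1+n _) j+1<N) j+1<N (ℕ.<⇒≢ (ℕ.n<1+n _))

both-false : ∀ {A B : Set} → ¬ A → ¬ B → A ⇔ B
both-false ¬a ¬b = mk⇔ (⊥-elim ∘ ¬a) (⊥-elim ∘ ¬b)

module _ {N F} (distinct : Distinct N F) {j} (¬peak : ¬ Peak N F (suc j)) (bound : suc (suc j) < N) where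

  ascent-continues : F j <ᶻ F (suc j) → F (suc j) <ᶻ F (suc (suc j))
  ascent-continues asc =
    ≢∧≮⇒> (distinct-adjacent distinct bound ∘ sym) (λ desc → ¬peak (bound , asc , desc))

  descent-precedes : F (suc (suc j)) <ᶻ F (suc j) → F (suc j) <ᶻ F j
  descent-precedes desc =
    ≢∧≮⇒> (distinct-adjacent distinct (ℕ.<-trans (ℕ.n<1+n _) bound)) (λ asc → ¬peak (bound , asc , desc))

adjacent-non-peaks : ∀ {N} F i q → N ≡ suc q ℕ.* 2 ℕ.+ i → ¬ Peak N F i →
                     Σ ℕ λ i′ → suc i′ < N × ¬ Peak N F i′ × ¬ Peak N F (suc i′)
adjacent-non-peaks {N} F i q N≡ ¬peakᵢ with peak? N F (suc i)
... | no ¬peakᵢ₊₁ = i , subst (suc i <_) (sym N≡) (s≤s (s≤s (ℕ.m≤n+m i _))) , ¬peakᵢ , ¬peakᵢ₊₁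
... | yes (bound , _ , desc) with q
...   | zero    = ⊥-elim (ℕ.n≮n _ (subst (suc (suc i) <_) N≡ bound))
...   | suc q′  = adjacent-non-peaks F (suc (suc i)) q′ N≡′ (λ (_ , asc , _) → ℤ.<-asym desc asc)
  where
  N≡′ : N ≡ suc q′ ℕ.* 2 ℕ.+ suc (suc i)
  N≡′ = trans N≡ (sym (trans (ℕ.+-suc (suc q′ ℕ.* 2) (suc i)) (cong suc (ℕ.+-suc (suc q′ ℕ.* 2) i))))

removable-ascent : ∀ {M F i} → suc i < suc M → Distinct (suc M) F →
                   ¬ Peak (suc M) F i → ¬ Peak (suc M) F (suc i) → F i <ᶻ F (suc i) →
                   Removable M F (suc i)
removable-ascent {M} {F} {i} i+1<1+M distinct ¬peakᵢ ¬peakᵢ₊₁ asc = record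
  { not-peak  = ¬peakᵢ₊₁
  ; peak-pred = λ { refl → both-false ¬peakᵢ (¬peakᴴ i refl) }
  ; peak-succ = mk⇔
      (λ (bound , l , u) → peak-via H (ℕ.≤-pred bound) Hᵢ Hᵢ₊₁ Hᵢ₊₂ (ℤ.<-trans asc l) u)
      (λ (bound , _ , u) → peak-via F (s≤s bound) refl refl refl
                             (rises (ℕ.m<n⇒m<1+n bound)) (subst₂ _<ᶻ_ Hᵢ₊₂ Hᵢ₊₁ u))
  }
  where
  H = F ∘ punchInℕ (suc i)
  rises : suc (suc i) < suc M → F (suc i) <ᶻ F (suc (suc i))
  rises bound = ascent-continues distinct ¬peakᵢ₊₁ bound asc
  Hᵢ : H i ≡ F i
  Hᵢ = cong F (punchInℕ-< (ℕ.n<1+n i))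
  Hᵢ₊₁ : H (suc i) ≡ F (suc (suc i))
  Hᵢ₊₁ = cong F (punchInℕ-≥ ℕ.≤-refl)
  Hᵢ₊₂ : H (suc (suc i)) ≡ F (suc (suc (suc i)))
  Hᵢ₊₂ = cong F (punchInℕ-≥ (ℕ.n≤1+n _))
  ¬peakᴴ : ∀ c → c ≡ i → ¬ Peak M H c
  ¬peakᴴ (suc c) refl (bound , _ , u) =
    ℤ.<-asym (subst₂ _<ᶻ_ Hᵢ₊₁ Hᵢ u) (ℤ.<-trans asc (rises (s≤s bound)))

removable-descent : ∀ {M F i} → suc i < suc M → Distinct (suc M) F →
                    ¬ Peak (suc M) F i → ¬ Peak (suc M) F (suc i) → F (suc i) <ᶻ F i →
                    Removable M F i
removable-descent {M} {F} {i} i+1<1+M distinct ¬peakᵢ ¬peakᵢ₊₁ desc = record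
  { not-peak  = ¬peakᵢ
  ; peak-pred = peak-pred
  ; peak-succ = both-false ¬peakᵢ₊₁ (¬peakᴴ i refl)
  }
  where
  H = F ∘ punchInℕ i
  falls : ∀ {c} → suc c ≡ i → F i <ᶻ F c
  falls refl = descent-precedes distinct ¬peakᵢ i+1<1+M desc
  peak-pred : ∀ {c} → suc c ≡ i → Peak (suc M) F c ⇔ Peak M H c
  peak-pred {zero}  _    = both-false (λ ()) (λ ())
  peak-pred {suc c} refl = mk⇔
    (λ (_ , l , _) → peak-via H (ℕ.≤-pred i+1<1+M) (cong F Hc) (cong F Hc+1) (cong F Hc+2)
                       l (ℤ.<-trans desc (falls refl)))
    (λ (_ , l , _) → ℕ.<-trans (ℕ.n<1+n _) i+1<1+M , subst₂ _<ᶻ_ (cong F Hc) (cong F Hc+1) l , falls refl)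
    where
    Hc   = punchInℕ-< (ℕ.<-trans (ℕ.n<1+n c) (ℕ.n<1+n (suc c)))
    Hc+1 = punchInℕ-< (ℕ.n<1+n (suc c))
    Hc+2 = punchInℕ-≥ ℕ.≤-refl
  ¬peakᴴ : ∀ c → c ≡ i → ¬ Peak M H c
  ¬peakᴴ (suc c) refl (_ , l , _) =
    ℤ.<-asym (subst₂ _<ᶻ_ (cong F (punchInℕ-< (ℕ.n<1+n c))) (cong F (punchInℕ-≥ ℕ.≤-refl)) l)
             (ℤ.<-trans desc (falls refl))

removable-position : ∀ {M} F → 2 ∣ suc M → Distinct (suc M) F → Σ ℕ λ r → r ≤ M × Removable M F r
removable-position F (divides (suc q) eq) distinct
  with adjacent-non-peaks F 0 q (trans eq (sym (ℕ.+-identityʳ _))) (λ ())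
... | i , i+1<N , ¬peakᵢ , ¬peakᵢ₊₁ with F i ℤ.<? F (suc i)
...   | yes asc = suc i , ℕ.≤-pred i+1<N , removable-ascent i+1<N distinct ¬peakᵢ ¬peakᵢ₊₁ asc
...   | no ¬asc = i , ℕ.<⇒≤ (ℕ.≤-pred i+1<N) , removable-descent i+1<N distinct ¬peakᵢ ¬peakᵢ₊₁
                        (≢∧≮⇒> (distinct-adjacent distinct i+1<N) ¬asc)

-- G ranges over the sequences obtained from H by inserting z at position s.
InsertionPoint : ℕ → (ℕ → ℤ) → ℤ → ℕ → Set
InsertionPoint M H z s =
  ∀ G → G s ≡ z → (∀ {j} → j < M → G (punchInℕ s j) ≡ H j) → Removable M G s

module Inserted {M : ℕ} {H : ℕ → ℤ} {z : ℤ} {s : ℕ} (G : ℕ → ℤ) (Gₛ : G s ≡ z)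
                (G≗H : ∀ {j} → j < M → G (punchInℕ s j) ≡ H j) where

  before : ∀ {j} → j < s → j < M → G j ≡ H j
  before j<s j<M = trans (cong G (sym (punchInℕ-< j<s))) (G≗H j<M)

  after : ∀ {j} → s ≤ j → j < M → G (suc j) ≡ H j
  after s≤j j<M = trans (cong G (sym (punchInℕ-≥ s≤j))) (G≗H j<M)

  peak-as-H : ∀ c → Peak M (G ∘ punchInℕ s) c ⇔ Peak M H c
  peak-as-H c = mk⇔ (peak-cong H c G≗H) (peak-cong (G ∘ punchInℕ s) c (sym ∘ G≗H))

insert-at-front : ∀ {M H z} → H 0 <ᶻ z ⊎ M ≤ 1 ⊎ H 0 <ᶻ H 1 → InsertionPoint M H z 0
insert-at-front {M} {H} {z} cond G Gₛ G≗H = record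
  { not-peak = λ () ; peak-pred = λ () ; peak-succ = both-false (¬peak₁ cond) (λ ()) }
  where
  open Inserted G Gₛ G≗H
  ¬peak₁ : H 0 <ᶻ z ⊎ M ≤ 1 ⊎ H 0 <ᶻ H 1 → ¬ Peak (suc M) G 1
  ¬peak₁ (inj₁ H₀<z)         (s≤s 1<M , l , _) =
    ℤ.<-asym H₀<z (subst₂ _<ᶻ_ Gₛ (after z≤n (ℕ.<-trans (s≤s z≤n) 1<M)) l)
  ¬peak₁ (inj₂ (inj₁ M≤1))   (s≤s 1<M , _ , _) = ℕ.<⇒≱ 1<M M≤1
  ¬peak₁ (inj₂ (inj₂ H₀<H₁)) (s≤s 1<M , _ , u) =
    ℤ.<-asym H₀<H₁ (subst₂ _<ᶻ_ (after z≤n 1<M) (after z≤n (ℕ.<-trans (s≤s z≤n) 1<M)) u)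

insert-into-descent : ∀ {M H z t} → suc t < M → z <ᶻ H t → H (suc t) <ᶻ z →
                      InsertionPoint M H z (suc t)
insert-into-descent {M} {H} {z} {t} t+1<M z<Hₜ Hₜ₊₁<z G Gₛ G≗H = record
  { not-peak  = λ (_ , l , _) → ℤ.<-asym z<Hₜ (subst₂ _<ᶻ_ Gₜ Gₛ l)
  ; peak-pred = λ { refl → ⇔.trans (peak-at t refl) (⇔.sym (peak-as-H t)) }
  ; peak-succ = ⇔.trans (both-false ¬peakᴳ ¬peakᴴ) (⇔.sym (peak-as-H (suc t)))
  }
  where
  open Inserted G Gₛ G≗H
  t<M = ℕ.<-trans (ℕ.n<1+n t) t+1<M
  Gₜ : G t ≡ H t
  Gₜ = before (ℕ.n<1+n t) t<M
  peak-at : ∀ c → c ≡ t → Peak (suc M) G c ⇔ Peak M H c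
  peak-at zero    _    = both-false (λ ()) (λ ())
  peak-at (suc c) refl = mk⇔
    (λ (_ , l , _) → t+1<M , subst₂ _<ᶻ_ G꜀ Gₜ l , ℤ.<-trans Hₜ₊₁<z z<Hₜ)
    (λ (_ , l , _) → ℕ.m<n⇒m<1+n t+1<M , subst₂ _<ᶻ_ (sym G꜀) (sym Gₜ) l ,
                     subst₂ _<ᶻ_ (sym Gₛ) (sym Gₜ) z<Hₜ)
    where G꜀ = before (ℕ.<-trans (ℕ.n<1+n c) (ℕ.n<1+n _)) (ℕ.<-trans (ℕ.n<1+n c) t<M)
  ¬peakᴳ : ¬ Peak (suc M) G (suc (suc t))
  ¬peakᴳ (_ , l , _) = ℤ.<-asym Hₜ₊₁<z (subst₂ _<ᶻ_ Gₛ (after ℕ.≤-refl t+1<M) l)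
  ¬peakᴴ : ¬ Peak M H (suc t)
  ¬peakᴴ (_ , l , _) = ℤ.<-asym l (ℤ.<-trans Hₜ₊₁<z z<Hₜ)

insert-into-valley : ∀ {M H z t} → suc (suc t) < M → (∀ {j} → j < M → z <ᶻ H j) →
                     H (suc t) <ᶻ H t → H (suc t) <ᶻ H (suc (suc t)) →
                     InsertionPoint M H z (suc (suc t))
insert-into-valley {M} {H} {z} {t} t+2<M z<H desc asc G Gₛ G≗H = record
  { not-peak  = λ (_ , l , _) → ℤ.<-asym (z<H t+1<M) (subst₂ _<ᶻ_ Gₜ₊₁ Gₛ l)
  ; peak-pred = λ { refl → ⇔.trans (both-false ¬peakᴳ (λ (_ , l , _) → ℤ.<-asym desc l))
                                   (⇔.sym (peak-as-H (suc t))) }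
  ; peak-succ = ⇔.trans (mk⇔
      (λ (bound , _ , u) → ℕ.≤-pred bound , asc , subst₂ _<ᶻ_ (after (ℕ.n≤1+n _) (ℕ.≤-pred bound)) Gₜ₊₃ u)
      (λ (bound , _ , u) → s≤s bound , subst₂ _<ᶻ_ (sym Gₛ) (sym Gₜ₊₃) (z<H t+2<M) ,
                           subst₂ _<ᶻ_ (sym (after (ℕ.n≤1+n _) bound)) (sym Gₜ₊₃) u))
      (⇔.sym (peak-as-H (suc (suc t))))
  }
  where
  open Inserted G Gₛ G≗H
  t+1<M = ℕ.<-trans (ℕ.n<1+n _) t+2<M
  Gₜ₊₁ : G (suc t) ≡ H (suc t)
  Gₜ₊₁ = before (ℕ.n<1+n _) t+1<M
  Gₜ₊₃ : G (suc (suc (suc t))) ≡ H (suc (suc t))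
  Gₜ₊₃ = after ℕ.≤-refl t+2<M
  ¬peakᴳ : ¬ Peak (suc M) G (suc t)
  ¬peakᴳ (_ , l , _) =
    ℤ.<-asym desc (subst₂ _<ᶻ_ (before (ℕ.<-trans (ℕ.n<1+n t) (ℕ.n<1+n _)) (ℕ.<-trans (ℕ.n<1+n t) t+1<M)) Gₜ₊₁ l)

insert-at-end : ∀ {m H z} → H (suc m) <ᶻ H m → InsertionPoint (suc (suc m)) H z (suc (suc m))
insert-at-end {m} {H} {z} desc G Gₛ G≗H = record
  { not-peak  = λ (bound , _) → ℕ.n≮n _ bound
  ; peak-pred = λ { refl → both-false ¬peakᴳ (λ (bound , _) → ℕ.n≮n _ bound) }
  ; peak-succ = both-false (λ (bound , _) → ℕ.n≮n _ (ℕ.<-trans (ℕ.n<1+n _) bound))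
                           (λ (bound , _) → ℕ.n≮n _ (ℕ.<-trans (ℕ.n<1+n _) bound))
  }
  where
  open Inserted G Gₛ G≗H
  ¬peakᴳ : ¬ Peak (suc (suc (suc m))) G (suc m)
  ¬peakᴳ (_ , l , _) = ℤ.<-asym desc
    (subst₂ _<ᶻ_ (before (ℕ.<-trans (ℕ.n<1+n m) (ℕ.n<1+n _)) (ℕ.<-trans (ℕ.n<1+n m) (ℕ.n<1+n _)))
                 (before (ℕ.n<1+n _) (ℕ.n<1+n _)) l)

discrete-ivt : ∀ {p} {P : ℕ → Set p} → U.Decidable P →
               ∀ {b} → ¬ P 0 → P b → Σ ℕ λ t → suc t ≤ b × ¬ P t × P (suc t)
discrete-ivt P? {zero}  ¬P₀ Pb = ⊥-elim (¬P₀ Pb)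
discrete-ivt P? {suc b} ¬P₀ Pb with P? b
... | yes Pb′ = let t , t+1≤b , ¬Pₜ , Pₜ₊₁ = discrete-ivt P? ¬P₀ Pb′
                in t , ℕ.m≤n⇒m≤1+n t+1≤b , ¬Pₜ , Pₜ₊₁
... | no ¬Pb′ = b , ℕ.≤-refl , ¬Pb′ , Pb

insertion-point-below : ∀ {M H z} → Distinct M H → (∀ {j} → j < M → z <ᶻ H j) →
                        Σ ℕ λ s → s ≤ M × InsertionPoint M H z s
insertion-point-below {zero}        _ _ = 0 , z≤n , insert-at-front (inj₂ (inj₁ z≤n))
insertion-point-below {suc zero}    _ _ = 0 , z≤n , insert-at-front (inj₂ (inj₁ ℕ.≤-refl))
insertion-point-below {suc (suc m)} {H} distinct z<H with H 0 ℤ.<? H 1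
... | yes asc₀ = 0 , z≤n , insert-at-front (inj₂ (inj₂ asc₀))
... | no ¬asc₀ with H m ℤ.<? H (suc m)
...   | no ¬ascₘ = suc (suc m) , ℕ.≤-refl , insert-at-end (≢∧≮⇒> (distinct-adjacent distinct ℕ.≤-refl) ¬ascₘ)
...   | yes ascₘ =
  let t , t+1≤m , ¬ascₜ , ascₜ₊₁ = discrete-ivt (λ j → H j ℤ.<? H (suc j)) ¬asc₀ ascₘ
      t+1<M = s≤s (ℕ.m≤n⇒m≤1+n t+1≤m)
  in suc (suc t) , s≤s (s≤s (ℕ.<⇒≤ t+1≤m)) ,
     insert-into-valley (s≤s (s≤s t+1≤m)) z<H
       (≢∧≮⇒> (distinct-adjacent distinct t+1<M) ¬ascₜ) ascₜ₊₁

insertion-point : ∀ {M H z} → Distinct M H → (∀ {j} → j < M → H j ≢ z) →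
                  Σ ℕ λ s → s ≤ M × InsertionPoint M H z s
insertion-point {M} {H} {z} distinct z∉H with H 0 ℤ.<? z
... | yes H₀<z = 0 , z≤n , insert-at-front (inj₁ H₀<z)
... | no H₀≮z with ℕ.anyUpTo? (λ j → H j ℤ.<? z) M
...   | yes (j , j<M , Hⱼ<z) =
  let t , t+1≤j , ¬Hₜ<z , Hₜ₊₁<z = discrete-ivt (λ j → H j ℤ.<? z) H₀≮z Hⱼ<z
      t+1<M = ℕ.≤-<-trans t+1≤j j<M
  in suc t , ℕ.<⇒≤ t+1<M ,
     insert-into-descent t+1<M (≢∧≮⇒> (z∉H (ℕ.<-trans (ℕ.n<1+n t) t+1<M)) ¬Hₜ<z) Hₜ₊₁<z
...   | no ∄j = insertion-point-below distinct
                  (λ j<M → ≢∧≮⇒> (z∉H j<M) (λ Hⱼ<z → ∄j (_ , j<M , Hⱼ<z)))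

distinct-punchIn : ∀ {M F r} → r ≤ M → Distinct (suc M) F → Distinct M (F ∘ punchInℕ r)
distinct-punchIn {r = r} r≤M distinct a b a<M b<M a≢b =
  distinct _ _ (punchInℕ-bounded r≤M a<M) (punchInℕ-bounded r≤M b<M) (a≢b ∘ punchInℕ-injective r)

sign-flip-position : ∀ {M} F → 2 ∣ suc M → Distinct (suc M) F →
                     (∀ a b → a < suc M → b < suc M → a ≢ b → F a ≢ - F b) →
                     Σ ℕ λ r → Σ ℕ λ s → r ≤ M × s ≤ M ×
                       (∀ G → G s ≡ - F r → (∀ {j} → j < M → G (punchInℕ s j) ≡ F (punchInℕ r j)) →
                        ∀ x → Pinnacle (suc M) F x ⇔ Pinnacle (suc M) G x)
sign-flip-position {M} F even distinct antidistinct with removable-position F even distinct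
... | r , r≤M , removable
  with insertion-point {H = F ∘ punchInℕ r} {z = - F r} (distinct-punchIn r≤M distinct)
         (λ j<M → antidistinct _ r (punchInℕ-bounded r≤M j<M) (s≤s r≤M) (punchInℕᵣ≢r r _))
...   | s , s≤M , insertable = r , s , r≤M , s≤M , λ G Gₛ G≗H x →
  ⇔.trans (pinnacles-remove r≤M removable x)
 (⇔.trans (mk⇔ (pinnacle-cong (G ∘ punchInℕ s) (sym ∘ G≗H)) (pinnacle-cong (F ∘ punchInℕ r) G≗H))
          (⇔.sym (pinnacles-remove s≤M (insertable G Gₛ G≗H) x)))

-- The value 0 beyond the end is junk that Peak never inspects.
extend : ∀ {n} → (Fin n → ℤ) → ℕ → ℤ
extend {n} f j with j ℕ.<? n
... | yes j<n = f (fromℕ< j<n)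
... | no _    = 0ℤ

extend-fromℕ< : ∀ {n} (f : Fin n → ℤ) {j} (j<n : j < n) → extend f j ≡ f (fromℕ< j<n)
extend-fromℕ< {n} f {j} j<n with j ℕ.<? n
... | yes _   = refl
... | no j≮n  = ⊥-elim (j≮n j<n)

extend-toℕ : ∀ {n} (f : Fin n → ℤ) (i : Fin n) → extend f (toℕ i) ≡ f i
extend-toℕ f i = trans (extend-fromℕ< f (Fin.toℕ<n i)) (cong f (Fin.fromℕ<-toℕ i _))

sequence : ∀ {n} → SignedPerm n → ℕ → ℤ
sequence w = extend (oneLine w)

isPinnacle⇔pinnacle : ∀ {n} (w : SignedPerm n) x → IsPinnacle w x ⇔ Pinnacle n (sequence w) x
isPinnacle⇔pinnacle {n} w x = mk⇔
  (λ (j , j+2<n , l , u , e) → suc j ,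
      (j+2<n , subst₂ _<ᶻ_ (sym (at₀ j+2<n)) (sym (at₁ j+2<n)) l
             , subst₂ _<ᶻ_ (sym (at₂ j+2<n)) (sym (at₁ j+2<n)) u) ,
      trans (at₁ j+2<n) e)
  (λ { (suc j , (j+2<n , l , u) , e) → j , j+2<n ,
      subst₂ _<ᶻ_ (at₀ j+2<n) (at₁ j+2<n) l , subst₂ _<ᶻ_ (at₂ j+2<n) (at₁ j+2<n) u ,
      trans (sym (at₁ j+2<n)) e })
  where
  at₂ : ∀ {j} (j+2<n : suc (suc j) < n) → sequence w (suc (suc j)) ≡ _
  at₂ j+2<n = extend-fromℕ< (oneLine w) j+2<n
  at₁ : ∀ {j} (j+2<n : suc (suc j) < n) → sequence w (suc j) ≡ _
  at₁ j+2<n = extend-fromℕ< (oneLine w) (ℕ.<-trans (ℕ.n<1+n _) j+2<n)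
  at₀ : ∀ {j} (j+2<n : suc (suc j) < n) → sequence w j ≡ _
  at₀ j+2<n = extend-fromℕ< (oneLine w) (ℕ.<-trans (ℕ.n<1+n _) (ℕ.<-trans (ℕ.n<1+n _) j+2<n))

∣oneLine∣ : ∀ {n} (w : SignedPerm n) i → ℤ.∣ oneLine w i ∣ ≡ suc (toℕ (SignedPerm.perm w ⟨$⟩ʳ i))
∣oneLine∣ w i with SignedPerm.neg w i
... | true  = refl
... | false = refl

∣sequence∣-injective : ∀ {n} (w : SignedPerm n) {a b} → a < n → b < n →
                       ℤ.∣ sequence w a ∣ ≡ ℤ.∣ sequence w b ∣ → a ≡ b
∣sequence∣-injective w {a} {b} a<n b<n e = begin
  a                       ≡⟨ Fin.toℕ-fromℕ< a<n ⟨
  toℕ (fromℕ< a<n)        ≡⟨ cong toℕ (π-injective (Fin.toℕ-injective (ℕ.suc-injective π-eq))) ⟩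
  toℕ (fromℕ< b<n)        ≡⟨ Fin.toℕ-fromℕ< b<n ⟩
  b                       ∎
  where
  open ≡-Reasoning
  π-injective = Injection.injective (↔⇒↣ (SignedPerm.perm w))
  π-eq = begin
    suc (toℕ (SignedPerm.perm w ⟨$⟩ʳ fromℕ< a<n)) ≡⟨ ∣oneLine∣ w _ ⟨
    ℤ.∣ oneLine w (fromℕ< a<n) ∣                    ≡⟨ cong ℤ.∣_∣ (extend-fromℕ< (oneLine w) a<n) ⟨
    ℤ.∣ sequence w a ∣                              ≡⟨ e ⟩
    ℤ.∣ sequence w b ∣                              ≡⟨ cong ℤ.∣_∣ (extend-fromℕ< (oneLine w) b<n) ⟩
    ℤ.∣ oneLine w (fromℕ< b<n) ∣                    ≡⟨ ∣oneLine∣ w _ ⟩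
    suc (toℕ (SignedPerm.perm w ⟨$⟩ʳ fromℕ< b<n)) ∎

sequence-distinct : ∀ {n} (w : SignedPerm n) → Distinct n (sequence w)
sequence-distinct w a b a<n b<n a≢b = a≢b ∘ ∣sequence∣-injective w a<n b<n ∘ cong ℤ.∣_∣

sequence-antidistinct : ∀ {n} (w : SignedPerm n) a b → a < n → b < n → a ≢ b →
                        sequence w a ≢ - sequence w b
sequence-antidistinct w a b a<n b<n a≢b e =
  a≢b (∣sequence∣-injective w a<n b<n (trans (cong ℤ.∣_∣ e) (ℤ.∣-i∣≡∣i∣ (sequence w b))))

-- Moves the entry w(r) to position s and negates it; the other entries keep
-- their order.
relocateNegated : ∀ {n} → SignedPerm (suc n) → Fin (suc n) → Fin (suc n) → SignedPerm (suc n)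
relocateNegated w r s = record
  { perm = insert s r id ∘ₚ SignedPerm.perm w
  ; neg  = λ i → does (s Fin.≟ i) xor SignedPerm.neg w (insert s r id ⟨$⟩ʳ i)
  }

module _ {n} (w : SignedPerm (suc n)) (r s : Fin (suc n)) where

  oneLine-relocateNegated : ∀ i → oneLine (relocateNegated w r s) i ≡
    (if does (s Fin.≟ i) then -_ else λ x → x) (oneLine w (insert s r id ⟨$⟩ʳ i))
  oneLine-relocateNegated i with does (s Fin.≟ i) | SignedPerm.neg w (insert s r id ⟨$⟩ʳ i)
  ... | true  | true  = refl
  ... | true  | false = refl
  ... | false | true  = refl
  ... | false | false = refl

  relocateNegated-at : oneLine (relocateNegated w r s) s ≡ - oneLine w r
  relocateNegated-at rewrite oneLine-relocateNegated s | proj₂ (dec-yes (s Fin.≟ s) refl) = refl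

  relocateNegated-punchIn : ∀ k → oneLine (relocateNegated w r s) (punchIn s k) ≡ oneLine w (punchIn r k)
  relocateNegated-punchIn k = begin
    oneLine (relocateNegated w r s) (punchIn s k)
      ≡⟨ oneLine-relocateNegated (punchIn s k) ⟩
    (if does (s Fin.≟ punchIn s k) then -_ else λ x → x) (oneLine w (σ ⟨$⟩ʳ punchIn s k))
      ≡⟨ cong (λ d → (if does d then -_ else λ x → x) (oneLine w (σ ⟨$⟩ʳ punchIn s k)))
              (dec-no (s Fin.≟ punchIn s k) (Fin.punchInᵢ≢i s k ∘ sym)) ⟩
    oneLine w (σ ⟨$⟩ʳ punchIn s k)
      ≡⟨ cong (oneLine w) (insert-punchIn s r id k) ⟩
    oneLine w (punchIn r k)
      ∎
    where
    open ≡-Reasoning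
    σ = insert s r id

toℕ-punchIn : ∀ {n} (r : Fin (suc n)) (k : Fin n) → toℕ (punchIn r k) ≡ punchInℕ (toℕ r) (toℕ k)
toℕ-punchIn Fin.zero    k           = refl
toℕ-punchIn (Fin.suc r) Fin.zero    = refl
toℕ-punchIn (Fin.suc r) (Fin.suc k) = cong suc (toℕ-punchIn r k)

sequence-punchInℕ : ∀ {M} (w : SignedPerm (suc M)) {r j} (r<1+M : r < suc M) (j<M : j < M) →
                    sequence w (punchInℕ r j) ≡ oneLine w (punchIn (fromℕ< r<1+M) (fromℕ< j<M))
sequence-punchInℕ w {r} {j} r<1+M j<M = begin
  sequence w (punchInℕ r j)
    ≡⟨ cong (sequence w) (cong₂ punchInℕ (Fin.toℕ-fromℕ< r<1+M) (Fin.toℕ-fromℕ< j<M)) ⟨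
  sequence w (punchInℕ (toℕ r′) (toℕ j′))
    ≡⟨ cong (sequence w) (toℕ-punchIn r′ j′) ⟨
  sequence w (toℕ (punchIn r′ j′))
    ≡⟨ extend-toℕ (oneLine w) (punchIn r′ j′) ⟩
  oneLine w (punchIn r′ j′)
    ∎
  where
  open ≡-Reasoning
  r′ = fromℕ< r<1+M
  j′ = fromℕ< j<M

isNegative : ℤ → ℕ
isNegative x = if does (x ℤ.<? 0ℤ) then 1 else 0

isNegative-+-isNegative-neg : ∀ x → x ≢ 0ℤ → isNegative x + isNegative (- x) ≡ 1
isNegative-+-isNegative-neg (+ zero)  x≢0 = ⊥-elim (x≢0 refl)
isNegative-+-isNegative-neg (+ suc n) _   = refl
isNegative-+-isNegative-neg -[1+ n ]  _   = refl

length-filter-tabulate : ∀ {n a p} {A : Set a} {P : A → Set p} (P? : U.Decidable P) (g : Fin n → A) →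
                         length (filter P? (tabulate g)) ≡ sum (λ i → if does (P? (g i)) then 1 else 0)
length-filter-tabulate {zero}  P? g = refl
length-filter-tabulate {suc n} P? g with does (P? (g Fin.zero))
... | true  = cong suc (length-filter-tabulate P? (g ∘ Fin.suc))
... | false = length-filter-tabulate P? (g ∘ Fin.suc)

negCount≡sum : ∀ {n} (w : SignedPerm n) → negCount w ≡ sum (isNegative ∘ oneLine w)
negCount≡sum w = length-filter-tabulate (λ i → oneLine w i ℤ.<? 0ℤ) (λ i → i)

even-or-odd : ∀ n → 2 ∣ n ⊎ 2 ∣ suc n
even-or-odd zero    = inj₁ (divides 0 refl)
even-or-odd (suc n) with even-or-odd n
... | inj₁ (divides q n≡) = inj₂ (divides (suc q) (cong (suc ∘ suc) n≡))
... | inj₂ 2∣1+n          = inj₁ 2∣1+n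

odd-+-swap : ∀ {a b} R → a + b ≡ 1 → ¬ 2 ∣ a + R → 2 ∣ b + R
odd-+-swap {zero}     R refl odd with even-or-odd R
... | inj₁ 2∣R   = ⊥-elim (odd 2∣R)
... | inj₂ 2∣1+R = 2∣1+R
odd-+-swap {suc zero} {zero} R refl odd with even-or-odd R
... | inj₁ 2∣R   = 2∣R
... | inj₂ 2∣1+R = ⊥-elim (odd 2∣1+R)

relocateNegated-flips-type : ∀ {n} (w : SignedPerm (suc n)) r s →
                             ¬ IsTypeD w → IsTypeD (relocateNegated w r s)
relocateNegated-flips-type w r s odd =
  subst (2 ∣_) (sym count′)
    (odd-+-swap R (isNegative-+-isNegative-neg (oneLine w r) oneLine≢0) (odd ∘ subst (2 ∣_) (sym count)))
  where
  open ≡-Reasoning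
  w′ = relocateNegated w r s
  R = sum (isNegative ∘ oneLine w ∘ punchIn r)
  oneLine≢0 : oneLine w r ≢ 0ℤ
  oneLine≢0 e = ℕ.0≢1+n (trans (sym (cong ℤ.∣_∣ e)) (∣oneLine∣ w r))
  count : negCount w ≡ isNegative (oneLine w r) + R
  count = trans (negCount≡sum w) (sum-remove (isNegative ∘ oneLine w))
  count′ : negCount w′ ≡ isNegative (- oneLine w r) + R
  count′ = begin
    negCount w′                                                      ≡⟨ negCount≡sum w′ ⟩
    sum (isNegative ∘ oneLine w′)                                    ≡⟨ sum-remove (isNegative ∘ oneLine w′) ⟩
    isNegative (oneLine w′ s) + sum (isNegative ∘ oneLine w′ ∘ punchIn s)
      ≡⟨ cong₂ _+_ (cong isNegative (relocateNegated-at w r s))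
                   (sum-cong-≗ (cong isNegative ∘ relocateNegated-punchIn w r s)) ⟩
    isNegative (- oneLine w r) + R                                   ∎

module _ {M} (w : SignedPerm (suc M)) {r s} (r<1+M : r < suc M) (s<1+M : s < suc M) where
  private
    r′ = fromℕ< r<1+M
    s′ = fromℕ< s<1+M
    w′ = relocateNegated w r′ s′

  sequence-relocateNegated-at : sequence w′ s ≡ - sequence w r
  sequence-relocateNegated-at = begin
    sequence w′ s   ≡⟨ extend-fromℕ< (oneLine w′) s<1+M ⟩
    oneLine w′ s′   ≡⟨ relocateNegated-at w r′ s′ ⟩
    - oneLine w r′  ≡⟨ cong -_ (extend-fromℕ< (oneLine w) r<1+M) ⟨
    - sequence w r  ∎
    where open ≡-Reasoning

  sequence-relocateNegated-punchInℕ : ∀ {j} → j < M →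
                                      sequence w′ (punchInℕ s j) ≡ sequence w (punchInℕ r j)
  sequence-relocateNegated-punchInℕ {j} j<M = begin
    sequence w′ (punchInℕ s j)           ≡⟨ sequence-punchInℕ w′ s<1+M j<M ⟩
    oneLine w′ (punchIn s′ (fromℕ< j<M)) ≡⟨ relocateNegated-punchIn w r′ s′ (fromℕ< j<M) ⟩
    oneLine w (punchIn r′ (fromℕ< j<M))  ≡⟨ sequence-punchInℕ w r<1+M j<M ⟨
    sequence w (punchInℕ r j)            ∎
    where open ≡-Reasoning

-- Opaque, so that typechecking its uses never evaluates the search for r and s.
opaque
  typeD-with-same-pinnacles : ∀ {M} (w : SignedPerm (suc M)) → 2 ∣ suc M → ¬ IsTypeD w →
                              Σ (SignedPerm (suc M)) λ w′ → IsTypeD w′ × (∀ x → IsPinnacle w x ⇔ IsPinnacle w′ x)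
  typeD-with-same-pinnacles {M} w even odd =
    let r , s , r≤M , s≤M , same-pinnacles =
          sign-flip-position (sequence w) even (sequence-distinct w) (sequence-antidistinct w)
        w′ = relocateNegated w (fromℕ< (s≤s r≤M)) (fromℕ< (s≤s s≤M))
    in w′ , relocateNegated-flips-type w (fromℕ< (s≤s r≤M)) (fromℕ< (s≤s s≤M)) odd , λ x →
         ⇔.trans (isPinnacle⇔pinnacle w x)
        (⇔.trans (same-pinnacles (sequence w′) (sequence-relocateNegated-at w (s≤s r≤M) (s≤s s≤M))
                                               (sequence-relocateNegated-punchInℕ w (s≤s r≤M) (s≤s s≤M)) x)
                 (⇔.sym (isPinnacle⇔pinnacle w′ x)))

theorem4p2 : ∀ (k : ℕ) → 1 ≤ k → ∀ (S : Subsetℤ) → InAPSB (2 * k) S ⇔ InAPSD (2 * k) S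
theorem4p2 zero    () S
theorem4p2 (suc k) _  S = mk⇔ typeB⇒typeD (λ (w , _ , pinnacles) → w , pinnacles)
  where
  typeB⇒typeD : InAPSB (2 * suc k) S → InAPSD (2 * suc k) S
  typeB⇒typeD (w , pinnacles) with 2 ∣? negCount w
  ... | yes typeD = w , typeD , pinnacles
  ... | no ¬typeD =
    let w′ , typeD , same = typeD-with-same-pinnacles w (m∣m*n (suc k)) ¬typeD
    in  w′ , typeD , λ x → ⇔.trans (pinnacles x) (same x)
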